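{- There exists an $S(3,K_4^{(3)}+e,v)$ for every $v\in\{10,12,15\}$.
   Context: $K_4^{(3)}+e$ denotes the 3-uniform hypergraph with vertex set $\{1,2,3,4,5\}$ and edge set $\{\{1,2,3\},\{1,2,4\},\{1,3,4\},\{2,3,4\},\{3,4,5\}\}$. An $S(3,K_4^{(3)}+e,v)$ is a partition of the set of all 3-subsets of a $v$-set into sub-hypergraphs each isomorphic to $K_4^{(3)}+e$ (a decomposition of the complete 3-uniform hypergraph $K_v^{(3)}$ into copies of $K_4^{(3)}+e$). -}

module Defs where

open import Data.Nat using (ℕ)
open import Data.Fin using (Fin; zero; suc)
open import Data.Fin.Subset using (Subset; ⁅_⁆; _∪_; ∣_∣)
open import Data.Bool using (Bool)
import Data.Bool as Bool
open import Data.Vec.Properties using (≡-dec)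
open import Data.List using (List; []; _∷_; length; filter; concatMap; map)
open import Data.List.Relation.Unary.All using (All)
open import Data.Product using (_×_; _,_)
open import Relation.Nullary using (Dec)
open import Function.Definitions using (Injective)
open import Relation.Binary.PropositionalEquality using (_≡_)

-- Vertex labels 1..5 of K_4^(3)+e are represented by Fin 5 indices 0..4.
v1 v2 v3 v4 v5 : Fin 5
v1 = zero
v2 = suc zero
v3 = suc (suc zero)
v4 = suc (suc (suc zero))
v5 = suc (suc (suc (suc zero)))

K4+e-edges : List (Fin 5 × Fin 5 × Fin 5)
K4+e-edges =
  (v1 , v2 , v3) ∷ (v1 , v2 , v4) ∷ (v1 , v3 , v4) ∷ (v2 , v3 , v4) ∷ (v3 , v4 , v5) ∷ []

-- A copy of K_4^(3)+e in K_v^(3) is given by an injective map of its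
-- vertex set into the v-set; its edges are the images of the five edges.
Copy : ℕ → Set
Copy v = Fin 5 → Fin v

edgeImage : ∀ {v} → Copy v → Fin 5 × Fin 5 × Fin 5 → Subset v
edgeImage f (a , b , c) = ⁅ f a ⁆ ∪ (⁅ f b ⁆ ∪ ⁅ f c ⁆)

allEdges : ∀ {v} → List (Copy v) → List (Subset v)
allEdges blocks = concatMap (λ f → map (edgeImage f) K4+e-edges) blocks

_≟ₛ_ : ∀ {v} (S T : Subset v) → Dec (S ≡ T)
_≟ₛ_ = ≡-dec Bool._≟_

IsDecomposition : (v : ℕ) → List (Copy v) → Set
IsDecomposition v blocks =
  All (Injective _≡_ _≡_) blocks ×
  (∀ (S : Subset v) → ∣ S ∣ ≡ 3 → length (filter (_≟ₛ S) (allEdges blocks)) ≡ 1)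

module Submission where

-- Each design is given by a small set of base blocks developed under a cyclic
-- group, as is customary for such constructions:
--   * v = 10: 12 base blocks on ℤ₁₀, developed under the involution x ↦ x + 5;
--   * v = 12: 4 base blocks on ℤ₁₁ ∪ {∞}, developed under ℤ₁₁ (∞ is fixed);
--   * v = 15: 7 base blocks on ℤ₁₃ ∪ {∞₁, ∞₂}, developed under ℤ₁₃.
-- That the resulting families are decompositions is a finite check, carried
-- out by evaluation.

open import Defs
open import Data.Nat using (ℕ; zero; suc; NonZero; _+_)
import Data.Nat as ℕ
open import Data.Nat.DivMod using (_mod_)
open import Data.Nat.Properties using (suc-injective)
open import Data.Fin using (Fin; toℕ; splitAt; _↑ˡ_; _↑ʳ_; #_)
import Data.Fin.Properties as Fin
open import Data.Fin.Subset using (Subset; ∣_∣; inside; outside)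
open import Data.Vec using ([]; _∷_; lookup)
open import Data.List using (List; []; _∷_; length; filter; concatMap; map; upTo)
open import Data.List.Relation.Unary.All using (all?)
open import Data.Product using (Σ; _×_; _,_)
open import Data.Sum using (_⊎_; inj₁; inj₂; [_,_]′)
open import Data.Unit using (⊤; tt)
open import Function using (_∘_)
open import Function.Definitions using (Injective)
open import Relation.Nullary using (Dec; yes)
open import Relation.Nullary.Decidable using (True; toWitness; map′; _×-dec_; _→-dec_)
open import Relation.Binary.PropositionalEquality using (_≡_; refl)

Every : (n k : ℕ) → (Subset n → Set) → Set
Every zero    zero    P = P []
Every zero    (suc k) P = ⊤
Every (suc n) zero    P = Every n zero (λ S → P (outside ∷ S))
Every (suc n) (suc k) P =
  Every n (suc k) (λ S → P (outside ∷ S)) × Every n k (λ S → P (inside ∷ S))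

every-sound : ∀ n k (P : Subset n → Set) → Every n k P → ∀ S → ∣ S ∣ ≡ k → P S
every-sound zero    zero    P h       []            refl = h
every-sound zero    (suc k) P h       []            ()
every-sound (suc n) zero    P h       (outside ∷ S) eq   = every-sound n zero _ h S eq
every-sound (suc n) zero    P h       (inside ∷ S)  ()
every-sound (suc n) (suc k) P (h , _) (outside ∷ S) eq   = every-sound n (suc k) _ h S eq
every-sound (suc n) (suc k) P (_ , h) (inside ∷ S)  eq   = every-sound n k _ h S (suc-injective eq)

every? : ∀ n k (P : Subset n → Set) → (∀ S → Dec (P S)) → Dec (Every n k P)
every? zero    zero    P P? = P? []
every? zero    (suc k) P P? = yes tt
every? (suc n) zero    P P? = every? n zero _ (λ S → P? (outside ∷ S))
every? (suc n) (suc k) P P? =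
  every? n (suc k) _ (λ S → P? (outside ∷ S)) ×-dec every? n k _ (λ S → P? (inside ∷ S))

injective? : ∀ {m n} (f : Fin m → Fin n) → Dec (Injective _≡_ _≡_ f)
injective? f = map′ (λ h {x} {y} → h x y) (λ h x y → h {x} {y})
  (Fin.all? λ x → Fin.all? λ y → (f x Fin.≟ f y) →-dec (x Fin.≟ y))

occurrences : ∀ {v} → List (Subset v) → Subset v → ℕ
occurrences es S = length (filter (_≟ₛ S) es)

-- Whether every 3-subset occurs exactly once in `es` is decidable.  Taking the
-- edge list as an argument lets evaluation compute it once, not once per S.
exactlyOnce? : ∀ v (es : List (Subset v)) → Dec (Every v 3 (λ S → occurrences es S ≡ 1))
exactlyOnce? v es = every? v 3 _ (λ S → occurrences es S ℕ.≟ 1)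

IsVerifiedDecomposition : (v : ℕ) → List (Copy v) → Set
IsVerifiedDecomposition v blocks =
  True (all? injective? blocks) × True (exactlyOnce? v (allEdges blocks))

verified⇒decomposition : ∀ v blocks → IsVerifiedDecomposition v blocks → IsDecomposition v blocks
verified⇒decomposition v blocks (inj , exact) =
  toWitness inj , every-sound v 3 _ (toWitness exact)

copy : ∀ {v} → Fin v → Fin v → Fin v → Fin v → Fin v → Copy v
copy a b c d e = lookup (a ∷ b ∷ c ∷ d ∷ e ∷ [])

-- On the point set ℤₘ ∪ {∞₁, …, ∞ᵣ} (as Fin (m + r)), translation by t acts
-- on ℤₘ and fixes the points at infinity.
translate : ∀ m {r} .{{_ : NonZero m}} → ℕ → Fin (m + r) → Fin (m + r)
translate m {r} t x = [ (λ a → ((toℕ a + t) mod m) ↑ˡ r) , m ↑ʳ_ ]′ (splitAt m x)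

develop : ∀ m {r} .{{_ : NonZero m}} → List ℕ → List (Copy (m + r)) → List (Copy (m + r))
develop m shifts base = concatMap (λ b → map (λ t → translate m t ∘ b) shifts) base

design10 : List (Copy 10)
design10 = develop 10 {0} (0 ∷ 5 ∷ [])
  ( copy (# 3) (# 9) (# 5) (# 6) (# 0)
  ∷ copy (# 0) (# 3) (# 2) (# 5) (# 6)
  ∷ copy (# 2) (# 7) (# 0) (# 4) (# 5)
  ∷ copy (# 1) (# 7) (# 5) (# 6) (# 4)
  ∷ copy (# 1) (# 9) (# 6) (# 8) (# 5)
  ∷ copy (# 3) (# 9) (# 0) (# 4) (# 6)
  ∷ copy (# 2) (# 8) (# 0) (# 9) (# 6)
  ∷ copy (# 1) (# 4) (# 7) (# 9) (# 0)
  ∷ copy (# 3) (# 8) (# 2) (# 4) (# 1)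
  ∷ copy (# 1) (# 3) (# 5) (# 8) (# 2)
  ∷ copy (# 3) (# 9) (# 1) (# 2) (# 5)
  ∷ copy (# 1) (# 7) (# 2) (# 8) (# 6)
  ∷ [])

design12 : List (Copy 12)
design12 = develop 11 {1} (upTo 11)
  ( copy (# 0) (# 1) (# 9) (# 11) (# 5)
  ∷ copy (# 0) (# 2) (# 4) (# 10) (# 11)
  ∷ copy (# 0) (# 2) (# 5) (# 6) (# 7)
  ∷ copy (# 0) (# 3) (# 6) (# 10) (# 1)
  ∷ [])

design15 : List (Copy 15)
design15 = develop 13 {2} (upTo 13)
  ( copy (# 0) (# 5) (# 2) (# 14) (# 13)
  ∷ copy (# 0) (# 6) (# 4) (# 5) (# 14)
  ∷ copy (# 0) (# 13) (# 5) (# 11) (# 14)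
  ∷ copy (# 0) (# 3) (# 5) (# 9) (# 14)
  ∷ copy (# 0) (# 5) (# 10) (# 12) (# 8)
  ∷ copy (# 0) (# 3) (# 6) (# 7) (# 11)
  ∷ copy (# 0) (# 13) (# 1) (# 4) (# 2)
  ∷ [])

lemma3p2 : (v : ℕ) → v ≡ 10 ⊎ v ≡ 12 ⊎ v ≡ 15 →
    Σ (List (Copy v)) (λ blocks → IsDecomposition v blocks)
lemma3p2 .10 (inj₁ refl)        = design10 , verified⇒decomposition 10 design10 (tt , tt)
lemma3p2 .12 (inj₂ (inj₁ refl)) = design12 , verified⇒decomposition 12 design12 (tt , tt)
lemma3p2 .15 (inj₂ (inj₂ refl)) = design15 , verified⇒decomposition 15 design15 (tt , tt)
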